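{- Let $\mathcal{H}$ be a $\lambda$-edge-connected hypergraph and let $B=B(X,Y)$ be its incidence graph with $X=V(\mathcal{H})$ and $Y=E(\mathcal{H})$. Let $R\subseteq V(B)$ with $R\cap X\neq\emptyset$, and let $D$ be a component of $B-R$. Then $e_B(R,D)\ge\lambda$ unless $V(D)=\{y\}$ for some $y\in Y$.
   Context: A hypergraph $\mathcal{H}$ consists of a finite vertex set and a finite multiset of edges, each edge a subset of the vertex set of size at least two. A Berge-path is an alternating sequence $v_1,e_1,\dots,e_l,v_{l+1}$ of distinct vertices and distinct edges with $\{v_i,v_{i+1}\}\subseteq e_i$; $\mathcal{H}$ is connected if any two vertices are joined by a Berge-path, and $\lambda$-edge-connected if deleting any set of at most $\lambda-1$ edges leaves it connected. The incidence graph of $\mathcal{H}$ is the simple bipartite graph $B$ with parts $X=V(\mathcal{H})$ and $Y=E(\mathcal{H})$ (each edge of the multiset a separate vertex), with $v\in X$ adjacent to $e\in Y$ iff $v\in e$. For disjoint vertex sets $A,C$ of a graph, $e_B(A,C)$ is the number of edges with one end in $A$ and the other in $C$. -}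

module Defs where

open import Data.Nat using (ℕ; zero; suc; _+_; _<_; _≤_)
open import Data.Fin using (Fin; zero; suc; fromℕ; inject₁)
open import Data.Fin.Subset using (Subset; _∈_; _∉_; ∣_∣)
open import Data.Bool using (Bool; true; false; _∧_; _∨_; if_then_else_)
open import Data.Sum using (_⊎_; inj₁; inj₂)
open import Data.Product using (Σ; ∃; ∃-syntax; _×_; _,_)
open import Data.List using (List; map; allFin; concatMap)
open import Data.Nat.ListAction using (sum)
open import Data.Empty using (⊥)
open import Function.Definitions using (Injective)
open import Relation.Binary.PropositionalEquality using (_≡_)
open import Relation.Nullary using (¬_)

-- A hypergraph with vertex set Fin n and an edge multiset indexed by Fin m
-- (repeated edges are allowed since distinct indices may have equal incidence).
-- inc e v ≡ true  iff  vertex v belongs to edge e.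
record Hypergraph : Set where
  field
    n   : ℕ
    m   : ℕ
    inc : Fin m → Fin n → Bool
    edge-size : ∀ e → ∃[ u ] ∃[ v ] (¬ u ≡ v × inc e u ≡ true × inc e v ≡ true)

open Hypergraph public

record BergePath (H : Hypergraph) (S : Subset (m H)) (u w : Fin (n H)) : Set where
  field
    len   : ℕ
    verts : Fin (suc len) → Fin (n H)
    edges : Fin len → Fin (m H)
    verts-distinct : Injective _≡_ _≡_ verts
    edges-distinct : Injective _≡_ _≡_ edges
    start : verts zero ≡ u
    end   : verts (fromℕ len) ≡ w
    edges-kept : ∀ i → edges i ∉ S
    incident-left  : ∀ i → inc H (edges i) (verts (inject₁ i)) ≡ true
    incident-right : ∀ i → inc H (edges i) (verts (suc i)) ≡ true

ConnectedAfterDeleting : (H : Hypergraph) → Subset (m H) → Set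
ConnectedAfterDeleting H S = ∀ (u w : Fin (n H)) → BergePath H S u w

EdgeConnected : ℕ → Hypergraph → Set
EdgeConnected k H = ∀ (S : Subset (m H)) → ∣ S ∣ < k → ConnectedAfterDeleting H S

-- Incidence graph B: vertex set X ⊎ Y with X = Fin n (vertices), Y = Fin m (edges).
VB : Hypergraph → Set
VB H = Fin (n H) ⊎ Fin (m H)

AdjB : (H : Hypergraph) → VB H → VB H → Set
AdjB H (inj₁ v) (inj₁ _) = ⊥
AdjB H (inj₁ v) (inj₂ e) = inc H e v ≡ true
AdjB H (inj₂ e) (inj₁ v) = inc H e v ≡ true
AdjB H (inj₂ _) (inj₂ _) = ⊥

VSet : Hypergraph → Set
VSet H = VB H → Bool

data WalkIn (H : Hypergraph) (P : VSet H) : VB H → VB H → Set where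
  here : ∀ {x} → P x ≡ true → WalkIn H P x x
  step : ∀ {x y z} → P x ≡ true → AdjB H x y → WalkIn H P y z → WalkIn H P x z

-- D is (the vertex set of) a component of B - R: nonempty, disjoint from R,
-- B[D] connected, and D closed under adjacency in B - R (maximality).
IsComponent : (H : Hypergraph) → (R D : VSet H) → Set
IsComponent H R D =
  (∃[ x ] D x ≡ true) ×
  (∀ x → D x ≡ true → R x ≡ false) ×
  (∀ x y → D x ≡ true → D y ≡ true → WalkIn H D x y) ×
  (∀ x y → D x ≡ true → R y ≡ false → AdjB H x y → D y ≡ true)

-- e_B(R, D): number of edges of B with one end in R and the other in D.
-- Edges of B are the pairs (v , e) with v ∈ e.
eB : (H : Hypergraph) → (R D : VSet H) → ℕ
eB H R D =
  sum (concatMap (λ v → map (λ e →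
        if inc H e v ∧ ((R (inj₁ v) ∧ D (inj₂ e)) ∨ (D (inj₁ v) ∧ R (inj₂ e)))
        then 1 else 0) (allFin (m H))) (allFin (n H)))

-- Let S be the set of hyperedges e of H such that some B-edge ve joins R and D.
-- There are at most e_B(R,D) of them, and in H − S the component D is closed:
-- a vertex of D can only leave D through an edge e ∉ S, which then lies in
-- B − R and hence in D, and symmetrically from edges back to vertices.  So if D
-- contains a vertex v of H, no Berge-path of H − S joins v to a vertex of R,
-- whence |S| ≥ λ by λ-edge-connectivity.  If D contains no vertex of H, then
-- B[D] has no edges, so D is a single hyperedge y.

module Submission where

open import Defs
import Algebra.Properties.CommutativeMonoid.Sum as CommutativeMonoidSum
open import Data.Bool using (Bool; true; false; _∧_; _∨_; if_then_else_)
open import Data.Bool.Properties using (∨-zeroʳ; _≟_)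
open import Data.Empty using (⊥-elim)
open import Data.Fin using (Fin; zero; suc; fromℕ)
open import Data.Fin.Induction using (<-weakInduction)
open import Data.Fin.Properties using (any?)
open import Data.Fin.Subset using (Subset; _∈_; _∉_; ∣_∣)
open import Data.List using (List; concat; map; tabulate; allFin; concatMap)
open import Data.List.Properties using (map-tabulate)
import Data.Nat.ListAction as ListAction
open import Data.Nat.ListAction.Properties using (sum-++)
open import Data.Nat using (ℕ; zero; suc; _+_; _≤_; _≥_; _≤?_; z≤n)
open import Data.Nat.Properties
  using (+-0-commutativeMonoid; +-mono-≤; ≤-refl; ≤-trans; m≤m+n; m≤n+m; ≮⇒≥)
open import Data.Product using (∃-syntax; _×_; _,_; proj₁; proj₂)
open import Data.Sum using (_⊎_; inj₁; inj₂)
import Data.Vec as Vec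
open import Data.Vec.Properties using (lookup⇒[]=; lookup∘tabulate)
open import Function using (_∘_)
open import Relation.Nullary using (¬_; does; yes; no)
open import Relation.Nullary.Decidable using (dec-true)
open import Relation.Unary using (Pred; Decidable)
open import Relation.Binary.PropositionalEquality
  using (_≡_; _≢_; refl; sym; trans; cong; subst; module ≡-Reasoning)

open CommutativeMonoidSum +-0-commutativeMonoid using (sum; sum-syntax; sum-cong-≗; ∑-comm)

term≤∑ : ∀ {n} (f : Fin n → ℕ) i → f i ≤ sum f
term≤∑ f zero    = m≤m+n _ _
term≤∑ f (suc i) = ≤-trans (term≤∑ (f ∘ suc) i) (m≤n+m _ _)

sum-tabulate : ∀ {n} (f : Fin n → ℕ) → ListAction.sum (tabulate f) ≡ sum f
sum-tabulate {zero}  f = refl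
sum-tabulate {suc n} f = cong (f zero +_) (sum-tabulate (f ∘ suc))

sum-concat-tabulate : ∀ {n} (f : Fin n → List ℕ) →
  ListAction.sum (concat (tabulate f)) ≡ ∑[ i < n ] ListAction.sum (f i)
sum-concat-tabulate {zero}  f = refl
sum-concat-tabulate {suc n} f =
  trans (sum-++ (f zero) _) (cong (ListAction.sum (f zero) +_) (sum-concat-tabulate (f ∘ suc)))

sum-concatMap-allFin : ∀ {n m} (f : Fin n → Fin m → ℕ) →
  ListAction.sum (concatMap (λ i → map (f i) (allFin m)) (allFin n))
    ≡ ∑[ i < n ] ∑[ j < m ] f i j
sum-concatMap-allFin {n} {m} f = begin
  ListAction.sum (concat (map row (tabulate (λ i → i))))  ≡⟨ cong (ListAction.sum ∘ concat) (map-tabulate {n = n} (λ i → i) row) ⟩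
  ListAction.sum (concat (tabulate row))                  ≡⟨ sum-concat-tabulate row ⟩
  ∑[ i < n ] ListAction.sum (row i)                        ≡⟨ sum-cong-≗ rowSum ⟩
  ∑[ i < n ] ∑[ j < m ] f i j                              ∎
  where
  open ≡-Reasoning
  row : Fin n → List ℕ
  row i = map (f i) (allFin m)
  rowSum : ∀ i → ListAction.sum (row i) ≡ ∑[ j < m ] f i j
  rowSum i = trans (cong ListAction.sum (map-tabulate {n = m} (λ j → j) (f i))) (sum-tabulate (f i))

∣tabulate∣≤∑ : ∀ {m p} {P : Pred (Fin m) p} (P? : Decidable P) (f : Fin m → ℕ) →
  (∀ i → P i → 1 ≤ f i) → ∣ Vec.tabulate (does ∘ P?) ∣ ≤ sum f
∣tabulate∣≤∑ {zero}  P? f P⇒1≤f = z≤n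
∣tabulate∣≤∑ {suc m} P? f P⇒1≤f
  with P? zero | ∣tabulate∣≤∑ (P? ∘ suc) (f ∘ suc) (P⇒1≤f ∘ suc)
... | yes P0 | rest = +-mono-≤ (P⇒1≤f zero P0) rest
... | no _   | rest = ≤-trans rest (m≤n+m _ (f zero))

∈-tabulate : ∀ {m p} {P : Pred (Fin m) p} (P? : Decidable P) {i} → P i →
  i ∈ Vec.tabulate (does ∘ P?)
∈-tabulate P? {i} Pi = lookup⇒[]= i _ (trans (lookup∘tabulate (does ∘ P?) i) (dec-true (P? i) Pi))

module _ (H : Hypergraph) (S : Subset (m H)) (P : VB H → Set)
  (vertex→edge : ∀ {v e} → inc H e v ≡ true → e ∉ S → P (inj₁ v) → P (inj₂ e))
  (edge→vertex : ∀ {v e} → inc H e v ≡ true → e ∉ S → P (inj₂ e) → P (inj₁ v))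
  where

  BergePath-preserves : ∀ {u w} → BergePath H S u w → P (inj₁ u) → P (inj₁ w)
  BergePath-preserves path Pu = subst (P ∘ inj₁) end (allVerts (fromℕ len))
    where
    open BergePath path
    allVerts : ∀ j → P (inj₁ (verts j))
    allVerts = <-weakInduction (P ∘ inj₁ ∘ verts) (subst (P ∘ inj₁) (sym start) Pu)
      λ i → edge→vertex (incident-right i) (edges-kept i)
          ∘ vertex→edge (incident-left i) (edges-kept i)

walk-source : ∀ {H P x z} → WalkIn H P x z → P x ≡ true
walk-source (here Px)     = Px
walk-source (step Px _ _) = Px

walk-from-edge-trivial : ∀ {H P y z} → (∀ v → P (inj₁ v) ≢ true) →
  WalkIn H P (inj₂ y) z → z ≡ inj₂ y
walk-from-edge-trivial noVertex (here _) = refl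
walk-from-edge-trivial noVertex (step {y = inj₁ v} _ _ walk) = ⊥-elim (noVertex v (walk-source walk))

module Cut (H : Hypergraph) (R D : VSet H) where

  crosses : Fin (n H) → Fin (m H) → Bool
  crosses v e = inc H e v ∧ ((R (inj₁ v) ∧ D (inj₂ e)) ∨ (D (inj₁ v) ∧ R (inj₂ e)))

  crossing : Fin (n H) → Fin (m H) → ℕ
  crossing v e = if crosses v e then 1 else 0

  cutDegree : Fin (m H) → ℕ
  cutDegree e = ∑[ v < n H ] crossing v e

  isCut? : Decidable (λ e → 1 ≤ cutDegree e)
  isCut? e = 1 ≤? cutDegree e

  cutEdges : Subset (m H)
  cutEdges = Vec.tabulate (does ∘ isCut?)

  eB≡∑cutDegree : eB H R D ≡ ∑[ e < m H ] cutDegree e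
  eB≡∑cutDegree = trans (sum-concatMap-allFin crossing) (∑-comm crossing)

  ∣cutEdges∣≤eB : ∣ cutEdges ∣ ≤ eB H R D
  ∣cutEdges∣≤eB = subst (∣ cutEdges ∣ ≤_) (sym eB≡∑cutDegree) (∣tabulate∣≤∑ isCut? cutDegree (λ _ 1≤d → 1≤d))

  crosses⇒∈cutEdges : ∀ {v e} → crosses v e ≡ true → e ∈ cutEdges
  crosses⇒∈cutEdges {v} {e} crosses-ve =
    ∈-tabulate isCut? (≤-trans 1≤crossing (term≤∑ (λ u → crossing u e) v))
    where
    1≤crossing : 1 ≤ crossing v e
    1≤crossing rewrite crosses-ve = ≤-refl

  crosses-R-D : ∀ {v e} → inc H e v ≡ true → R (inj₁ v) ≡ true → D (inj₂ e) ≡ true → crosses v e ≡ true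
  crosses-R-D v∈e Rv De rewrite v∈e | Rv | De = refl

  crosses-D-R : ∀ {v e} → inc H e v ≡ true → D (inj₁ v) ≡ true → R (inj₂ e) ≡ true → crosses v e ≡ true
  crosses-D-R {v} {e} v∈e Dv Re rewrite v∈e | Dv | Re = ∨-zeroʳ (R (inj₁ v) ∧ D (inj₂ e))

  module _ (component : IsComponent H R D) where

    private
      disjoint = proj₁ (proj₂ component)
      closed   = proj₂ (proj₂ (proj₂ component))

    vertex→edge : ∀ {v e} → inc H e v ≡ true → e ∉ cutEdges → D (inj₁ v) ≡ true → D (inj₂ e) ≡ true
    vertex→edge {v} {e} v∈e e∉cut Dv with R (inj₂ e) in Re
    ... | true  = ⊥-elim (e∉cut (crosses⇒∈cutEdges (crosses-D-R v∈e Dv Re)))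
    ... | false = closed (inj₁ v) (inj₂ e) Dv Re v∈e

    edge→vertex : ∀ {v e} → inc H e v ≡ true → e ∉ cutEdges → D (inj₂ e) ≡ true → D (inj₁ v) ≡ true
    edge→vertex {v} {e} v∈e e∉cut De with R (inj₁ v) in Rv
    ... | true  = ⊥-elim (e∉cut (crosses⇒∈cutEdges (crosses-R-D v∈e Rv De)))
    ... | false = closed (inj₂ e) (inj₁ v) De Rv v∈e

    cutEdges-separate : ∀ {v x} → D (inj₁ v) ≡ true → R (inj₁ x) ≡ true →
      ¬ ConnectedAfterDeleting H cutEdges
    cutEdges-separate {v} {x} Dv Rx connected with trans (sym Rx) (disjoint (inj₁ x) Dx)
      where
      Dx : D (inj₁ x) ≡ true
      Dx = BergePath-preserves H cutEdges (λ z → D z ≡ true) vertex→edge edge→vertex (connected v x) Dv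
    ... | ()

    edgeConnected⇒eB≥ : ∀ {k v x} → EdgeConnected k H → D (inj₁ v) ≡ true → R (inj₁ x) ≡ true → eB H R D ≥ k
    edgeConnected⇒eB≥ edgeConnected Dv Rx =
      ≤-trans (≮⇒≥ (λ cut<k → cutEdges-separate Dv Rx (edgeConnected cutEdges cut<k))) ∣cutEdges∣≤eB

component-without-vertex-is-edge : ∀ {H R D} → IsComponent H R D → (∀ v → D (inj₁ v) ≢ true) →
  ∃[ y ] (∀ z → (D z ≡ true → z ≡ inj₂ y) × (z ≡ inj₂ y → D z ≡ true))
component-without-vertex-is-edge ((inj₁ v , Dv) , _) noVertex = ⊥-elim (noVertex v Dv)
component-without-vertex-is-edge ((inj₂ y , Dy) , _ , connected , _) noVertex =
  y , λ z → (λ Dz → walk-from-edge-trivial noVertex (connected _ z Dy Dz)) , λ { refl → Dy }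

lemma1 : (k : ℕ) (H : Hypergraph) → EdgeConnected k H →
    (R D : VSet H) → (∃[ x ] R (inj₁ x) ≡ true) → IsComponent H R D →
    eB H R D ≥ k ⊎ (∃[ y ] (∀ z → (D z ≡ true → z ≡ inj₂ y) × (z ≡ inj₂ y → D z ≡ true)))
lemma1 k H edgeConnected R D (x , Rx) component with any? (λ v → D (inj₁ v) ≟ true)
... | yes (v , Dv) = inj₁ (Cut.edgeConnected⇒eB≥ H R D component edgeConnected Dv Rx)
... | no noVertex  = inj₂ (component-without-vertex-is-edge component (λ v Dv → noVertex (v , Dv)))
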